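{- There exists a cyclic $(45;22,22;21)$ difference family, i.e. there exist subsets $X_1,X_2\subseteq \mathbb{Z}_{45}$ with $|X_1|=|X_2|=22$ such that for every nonzero $a\in\mathbb{Z}_{45}$, $$\#\{(x,y)\in X_1\times X_1: y-x=a\}+\#\{(x,y)\in X_2\times X_2: y-x=a\}=21.$$
   Context: $\mathbb{Z}_v$ denotes the cyclic group (ring) of integers modulo $v$. A cyclic $(v;r,s;\lambda)$ difference family is a pair $(X_1,X_2)$ of subsets of $\mathbb{Z}_v$ with $|X_1|=r$, $|X_2|=s$ such that for every nonzero $a\in\mathbb{Z}_v$ the total number of ordered pairs $(x,y)$ with $x,y$ in the same block $X_i$ and $y-x=a$ equals $\lambda$. -}

module Defs where

open import Data.Nat using (ℕ; _+_; _∸_; _%_; NonZero)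
open import Data.Nat.DivMod using (m%n<n)
open import Data.Fin using (Fin; toℕ; fromℕ<; _≟_; zero)
open import Data.Fin.Subset using (Subset; _∈_; ∣_∣)
open import Data.Fin.Subset.Properties using (_∈?_)
open import Data.List using (List; length; filter; cartesianProduct; allFin)
open import Data.Product using (_×_; _,_)
open import Relation.Nullary using (_×-dec_)
open import Relation.Binary.PropositionalEquality using (_≡_; _≢_)

-- ℤ_v is represented by Fin v = {0,…,v-1}; a subset of ℤ_v is a Subset v.
-- Subtraction in ℤ_v:  sub y x = (y - x) mod v, computed as (y + (v ∸ x)) mod v.
sub : ∀ {v} .{{_ : NonZero v}} → Fin v → Fin v → Fin v
sub {v} y x = fromℕ< (m%n<n (toℕ y + (v ∸ toℕ x)) v)

diffPairs : ∀ {v} .{{_ : NonZero v}} → Subset v → Fin v → List (Fin v × Fin v)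
diffPairs {v} X a = filter P? (cartesianProduct (allFin v) (allFin v))
  where
  P? : (p : Fin v × Fin v) → _
  P? (x , y) = ((x ∈? X) ×-dec (y ∈? X)) ×-dec (sub y x ≟ a)

countDiff : ∀ {v} .{{_ : NonZero v}} → Subset v → Fin v → ℕ
countDiff X a = length (diffPairs X a)

record IsCyclicDF (v r s λ' : ℕ) .{{_ : NonZero v}} (X₁ X₂ : Subset v) : Set where
  field
    size₁ : ∣ X₁ ∣ ≡ r
    size₂ : ∣ X₂ ∣ ≡ s
    diffs : (a : Fin v) → toℕ a ≢ 0 → countDiff X₁ a + countDiff X₂ a ≡ λ'

-- Being a cyclic difference family is decidable, so exhibiting an explicit pair
-- suffices: the type checker evaluates the decision procedure on it to yes.

module Submission where

open import Defs
open import Data.Fin.Subset using (Subset; inside; outside; ∣_∣)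
open import Data.Product using (Σ; _,_)
open import Data.Nat using (NonZero; _+_; _≟_)
open import Data.Fin using (toℕ)
open import Data.Fin.Properties using (all?)
open import Data.Vec using (_∷_; [])
open import Relation.Nullary using (Dec; ¬?; _→-dec_; _×-dec_)
open import Relation.Nullary.Decidable using (map′; toWitness)

isCyclicDF? : ∀ v r s λ' .{{_ : NonZero v}} (X₁ X₂ : Subset v) →
              Dec (IsCyclicDF v r s λ' X₁ X₂)
isCyclicDF? v r s λ' X₁ X₂ =
  map′ (λ (size₁ , size₂ , diffs) → record { size₁ = size₁ ; size₂ = size₂ ; diffs = diffs })
       (λ df → IsCyclicDF.size₁ df , IsCyclicDF.size₂ df , IsCyclicDF.diffs df)
       ((∣ X₁ ∣ ≟ r) ×-dec (∣ X₂ ∣ ≟ s) ×-dec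
        all? (λ a → ¬? (toℕ a ≟ 0) →-dec (countDiff X₁ a + countDiff X₂ a ≟ λ')))

X₁ : Subset 45
X₁ = inside ∷ inside ∷ inside ∷ inside ∷ inside ∷ outside ∷ inside ∷ outside ∷ outside ∷ inside ∷ inside ∷ outside ∷ inside ∷ outside ∷ inside ∷ inside ∷ outside ∷ outside ∷ inside ∷ inside ∷ outside ∷ outside ∷ outside ∷ outside ∷ inside ∷ inside ∷ inside ∷ inside ∷ outside ∷ outside ∷ outside ∷ inside ∷ outside ∷ outside ∷ outside ∷ outside ∷ inside ∷ outside ∷ inside ∷ outside ∷ outside ∷ inside ∷ outside ∷ outside ∷ inside ∷ []

X₂ : Subset 45
X₂ = inside ∷ inside ∷ inside ∷ inside ∷ inside ∷ outside ∷ outside ∷ inside ∷ inside ∷ outside ∷ outside ∷ inside ∷ inside ∷ outside ∷ outside ∷ inside ∷ outside ∷ inside ∷ inside ∷ inside ∷ inside ∷ outside ∷ outside ∷ inside ∷ outside ∷ inside ∷ outside ∷ inside ∷ outside ∷ inside ∷ outside ∷ inside ∷ inside ∷ outside ∷ outside ∷ outside ∷ outside ∷ outside ∷ inside ∷ outside ∷ outside ∷ outside ∷ outside ∷ inside ∷ outside ∷ []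

mainTheorem2 : Σ (Subset 45) (λ X₁ → Σ (Subset 45) (λ X₂ → IsCyclicDF 45 22 22 21 X₁ X₂))
mainTheorem2 = X₁ , X₂ , toWitness {a? = isCyclicDF? 45 22 22 21 X₁ X₂} _
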